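{- Let $T>0$ and let $\sigma$ be a feasible schedule (in any of the non-preemptive, preemptive or splittable variants) with makespan $T$, and write its total load as $\mathrm{load}(\sigma)=\sum_{i=1}^c(\lambda_i^\sigma s_i+P(C_i))$, where $\lambda_i^\sigma$ is the number of setups of class $i$ in $\sigma$. Then $\lambda_i^\sigma\ge\alpha_i\ge1$ for all $i\in[c]$. Furthermore, if $i$ is expensive (i.e. $s_i>T/2$), then $\lambda_i^\sigma\ge\alpha_i\ge\beta_i\ge1$ and $\sigma$ needs at least $\lambda_i^\sigma$ different machines to place all jobs of $C_i$.
   Context: An instance consists of $m$ identical machines, jobs $J$ partitioned into nonempty classes $C_1,\dots,C_c$, processing times $t_j\in\mathbb{N}$ and setup times $s_i\in\mathbb{N}$; a setup of class $i$ (length $s_i$, never preempted) is required whenever a machine starts processing load of class $i$ or switches to class $i$ from a different class; each machine processes one item at a time. The load of a schedule is the sum over machines of all setup times and (piece) processing times placed on them. $P(K)=\sum_{j\in K}t_j$; $\alpha_i=\lceil P(C_i)/(T-s_i)\rceil$, $\beta_i=\lceil 2P(C_i)/T\rceil$.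
   Formalization: The makespan T, and all start times and piece lengths in the schedule σ, are rational numbers. -}

module Defs where

open import Data.Nat as ℕ using (ℕ; zero; suc)
open import Data.Integer as ℤ using (ℤ)
open import Data.Rational as ℚ using (ℚ; 0ℚ; _+_; _-_; _*_; _÷_; _<_; _≤_; ceiling; >-nonZero)
open import Data.Rational.Properties using (_<?_)
open import Data.Fin using (Fin; _≟_)
open import Data.List using (List; []; _∷_; map; length; concatMap; foldr; lookup)
open import Data.Nat.ListAction using (sum)
open import Data.List.Relation.Unary.All using (All)
open import Data.List.Relation.Unary.Any using (Any)
open import Data.Maybe using (Maybe; just; nothing)
open import Data.Product using (Σ; _×_; ∃; ∃-syntax; _,_)
open import Data.Sum using (_⊎_)
open import Data.Unit using (⊤)
open import Data.Bool using (Bool; true; false; if_then_else_; _∨_)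
open import Relation.Nullary using (does; yes; no; ¬_)
open import Relation.Binary.PropositionalEquality using (_≡_; _≢_)
open import Data.List.Base using (allFin)

toℚ : ℕ → ℚ
toℚ n = ℤ.+ n ℚ./ 1

record Instance : Set where
  field
    m c n : ℕ
    cls   : Fin n → Fin c
    t     : Fin n → ℕ
    t-pos : ∀ j → 1 ℕ.≤ t j
    s     : Fin c → ℕ
    nonempty : ∀ (i : Fin c) → ∃[ j ] cls j ≡ i

module _ (I : Instance) where
  open Instance I

  P : Fin c → ℕ
  P i = sum (map (λ j → if does (cls j ≟ i) then t j else 0) (allFin n))

  -- alpha_i = ⌈ P(C_i) / (T - s_i) ⌉ (given the default 0 when T ≤ s_i, where it is undefined)
  alpha : ℚ → Fin c → ℤ
  alpha T i with 0ℚ <? (T - toℚ (s i))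
  ... | yes p = ceiling ((toℚ (P i) ÷ (T - toℚ (s i))) {{>-nonZero p}})
  ... | no _  = ℤ.0ℤ

  -- beta_i = ⌈ 2 P(C_i) / T ⌉ (default 0 when T ≤ 0, where it is undefined)
  beta : ℚ → Fin c → ℤ
  beta T i with 0ℚ <? T
  ... | yes p = ceiling ((toℚ (2 ℕ.* P i) ÷ T) {{>-nonZero p}})
  ... | no _  = ℤ.0ℤ

  data Item : Set where
    setup : Fin c → Item
    piece : Fin n → ℚ → Item

  record Placed : Set where
    constructor _at_
    field
      item  : Item
      start : ℚ

  open Placed public

  len : Item → ℚ
  len (setup i)   = toℚ (s i)
  len (piece j ℓ) = ℓ

  classOf : Item → Fin c
  classOf (setup i)   = i
  classOf (piece j ℓ) = cls j

  finish : Placed → ℚ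
  finish p = start p + len (item p)

  Schedule : Set
  Schedule = Fin m → List Placed

  Sequential : List Placed → Set
  Sequential []           = ⊤
  Sequential (p ∷ [])     = ⊤
  Sequential (p ∷ q ∷ ps) = finish p ≤ start q × Sequential (q ∷ ps)

  -- setup rule: the machine's current configuration (class of the last setup)
  -- must be the class of every piece processed
  SetupOK : Maybe (Fin c) → List Placed → Set
  SetupOK st [] = ⊤
  SetupOK st ((setup i at _) ∷ ps)   = SetupOK (just i) ps
  SetupOK st ((piece j ℓ at _) ∷ ps) = st ≡ just (cls j) × SetupOK st ps

  PieceOK : Item → Set
  PieceOK (setup i)   = ⊤
  PieceOK (piece j ℓ) = 0ℚ < ℓ

  MachineOK : ℚ → List Placed → Set
  MachineOK T ps =
    All (λ p → 0ℚ ≤ start p × finish p ≤ T × PieceOK (item p)) ps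
    × Sequential ps × SetupOK nothing ps

  piecesOn : Fin n → List Placed → List (ℚ × ℚ)
  piecesOn j [] = []
  piecesOn j ((setup i at a) ∷ ps) = piecesOn j ps
  piecesOn j ((piece j' ℓ at a) ∷ ps) with j' ≟ j
  ... | yes _ = (a , a + ℓ) ∷ piecesOn j ps
  ... | no _  = piecesOn j ps

  pieces : Schedule → Fin n → List (ℚ × ℚ)
  pieces σ j = concatMap (λ k → piecesOn j (σ k)) (allFin m)

  sumℚ : List ℚ → ℚ
  sumℚ = foldr _+_ 0ℚ

  intervalLen : ℚ × ℚ → ℚ
  intervalLen (a , b) = b - a

  data Variant : Set where
    nonPreemptive preemptive splittable : Variant

  Disjoint : ℚ × ℚ → ℚ × ℚ → Set
  Disjoint (a , b) (a' , b') = b ≤ a' ⊎ b' ≤ a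

  VariantOK : Variant → Schedule → Set
  VariantOK nonPreemptive σ = ∀ j → length (pieces σ j) ≡ 1
  VariantOK preemptive σ =
    ∀ j (x y : Fin (length (pieces σ j))) → x ≢ y →
      Disjoint (lookup (pieces σ j) x) (lookup (pieces σ j) y)
  VariantOK splittable σ = ⊤

  Feasible : Variant → ℚ → Schedule → Set
  Feasible v T σ =
    (∀ k → MachineOK T (σ k))
    × (∀ j → sumℚ (map intervalLen (pieces σ j)) ≡ toℚ (t j))
    × VariantOK v σ

  Makespan : Schedule → ℚ → Set
  Makespan σ T = (∀ k → All (λ p → finish p ≤ T) (σ k))
               × ∃[ k ] Any (λ p → finish p ≡ T) (σ k)

  setupsOn : Fin c → List Placed → ℕ
  setupsOn i [] = 0
  setupsOn i ((setup i' at _) ∷ ps) = (if does (i' ≟ i) then 1 else 0) ℕ.+ setupsOn i ps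
  setupsOn i ((piece j ℓ at _) ∷ ps) = setupsOn i ps

  numSetups : Schedule → Fin c → ℕ
  numSetups σ i = sum (map (λ k → setupsOn i (σ k)) (allFin m))

  usesClass : Fin c → List Placed → Bool
  usesClass i [] = false
  usesClass i (p ∷ ps) = does (classOf (item p) ≟ i) ∨ usesClass i ps

  machinesFor : Schedule → Fin c → ℕ
  machinesFor σ i = sum (map (λ k → if usesClass i (σ k) then 1 else 0) (allFin m))

  load : Schedule → ℕ
  load σ = sum (map (λ i → numSetups σ i ℕ.* s i ℕ.+ P i) (allFin c))

  Expensive : ℚ → Fin c → Set
  Expensive T i = T * ℚ.½ < toℚ (s i)

module Submission where

-- Fix a class i and let D = T − s_i. On one machine, the class-i pieces that follow a
-- setup of class i lie between the end of that setup and T, so they take at most D;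
-- summing over machines gives P(C_i) ≤ λ_i D. Since P(C_i) > 0 this forces D > 0, and
-- then α_i = ⌈P(C_i)/D⌉ ≤ λ_i and α_i ≥ 1. If 2 s_i > T, two setups of class i do not fit
-- on one machine, so λ_i is bounded by the number of machines used by the class, and
-- 2D < T gives β_i = ⌈2P(C_i)/T⌉ ≤ α_i.

open import Defs

open import Data.Bool using (Bool; true; false; if_then_else_)
open import Data.Bool.Properties using (if-eta; if-swap-then)
open import Data.Fin using (Fin; zero; suc; _≟_)
open import Data.Integer as ℤ using (+_; +0; +[1+_]; -[1+_])
import Data.Integer.DivMod as ℤ
import Data.Integer.Properties as ℤ
open import Data.Integer.Tactic.RingSolver using (solve-∀)
open import Data.List using (List; []; _∷_; _++_; map; foldr; concatMap; tabulate; allFin)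
open import Data.List.Membership.Propositional using (_∈_)
open import Data.List.Membership.Propositional.Properties using (∈-allFin)
open import Data.List.Properties using (map-tabulate)
open import Data.List.Relation.Unary.All using (All; []; _∷_)
open import Data.List.Relation.Unary.Any using (here; there)
open import Data.Maybe using (Maybe; just; nothing)
open import Data.Nat as ℕ using (ℕ)
open import Data.Nat.Coprimality as Coprimality using (1-coprimeTo)
open import Data.Nat.ListAction using (sum)
import Data.Nat.Properties as ℕ
open import Data.Product using (∃-syntax; _×_; _,_; proj₁; proj₂)
open import Data.Rational as ℚ
  using (ℚ; mkℚ; ↥_; ↧_; ↧ₙ_; 0ℚ; 1ℚ; ½; _+_; _-_; _*_; _÷_; 1/_; _≤_; _<_; ceiling; >-nonZero; *≤*; *<*)
import Data.Rational.Properties as ℚ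
open import Data.Rational.Solver using (module +-*-Solver)
open import Relation.Binary.PropositionalEquality
  using (_≡_; refl; sym; trans; cong; cong₂; subst; subst₂; module ≡-Reasoning)
open import Relation.Nullary using (does; yes; no; contradiction)

ceiling-remainder : ∀ q → ∃[ r ] r ℕ.< ↧ₙ q × ceiling q ℤ.* ↧ q ≡ ↥ q ℤ.+ + r
ceiling-remainder q@(mkℚ num k _) = r , ℤ.n%d<d a d , (begin
  ceiling q ℤ.* d                    ≡⟨ cong (ℤ._* d) (ceiling≡ q) ⟩
  ℤ.- (a ℤ./ d) ℤ.* d                ≡⟨ shift (+ r) (a ℤ./ d) d ⟩
  ℤ.- (+ r ℤ.+ (a ℤ./ d) ℤ.* d) ℤ.+ + r ≡⟨ cong (λ x → ℤ.- x ℤ.+ + r) (sym (ℤ.a≡a%n+[a/n]*n a d)) ⟩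
  ℤ.- a ℤ.+ + r                      ≡⟨ cong (ℤ._+ + r) (ℤ.neg-involutive num) ⟩
  num ℤ.+ + r                        ∎)
  where
  open ≡-Reasoning
  a = ℤ.- num
  d = +[1+ k ]
  r = a ℤ.% d
  ceiling≡ : ∀ q → ceiling q ≡ ℤ.- ((ℤ.- ↥ q) ℤ./ ↧ q)
  ceiling≡ (mkℚ -[1+ n ] _ _) = refl
  ceiling≡ (mkℚ +0 _ _)       = refl
  ceiling≡ (mkℚ +[1+ n ] _ _) = refl
  shift : ∀ r f d → ℤ.- f ℤ.* d ≡ ℤ.- (r ℤ.+ f ℤ.* d) ℤ.+ r
  shift = solve-∀

↥≤ceiling*↧ : ∀ q → ↥ q ℤ.≤ ceiling q ℤ.* ↧ q
↥≤ceiling*↧ q with ceiling-remainder q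
... | r , _ , eq = subst (↥ q ℤ.≤_) (sym eq) (ℤ.i≤i+j (↥ q) (+ r))

ceiling-minimal : ∀ q z → ↥ q ℤ.≤ z ℤ.* ↧ q → ceiling q ℤ.≤ z
ceiling-minimal q@record{} z ↥q≤z↧q with ceiling-remainder q
... | r , r<↧q , eq = subst (ceiling q ℤ.≤_) (ℤ.pred-suc z)
  (ℤ.i<j⇒i≤pred[j] (ℤ.*-cancelʳ-<-nonNeg {ceiling q} {ℤ.suc z} (↧ q) (begin-strict
    ceiling q ℤ.* ↧ q   ≡⟨ eq ⟩
    ↥ q ℤ.+ + r         <⟨ ℤ.+-monoʳ-< (↥ q) (ℤ.+<+ r<↧q) ⟩
    ↥ q ℤ.+ ↧ q         ≤⟨ ℤ.+-monoˡ-≤ (↧ q) ↥q≤z↧q ⟩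
    z ℤ.* ↧ q ℤ.+ ↧ q   ≡⟨ ℤ.+-comm (z ℤ.* ↧ q) (↧ q) ⟩
    ↧ q ℤ.+ z ℤ.* ↧ q   ≡⟨ ℤ.suc-* z (↧ q) ⟨
    ℤ.suc z ℤ.* ↧ q     ∎)))
  where open ℤ.≤-Reasoning

ceiling-mono-≤ : ∀ {p q} → p ≤ q → ceiling p ℤ.≤ ceiling q
ceiling-mono-≤ {p@record{}} {q@record{}} (*≤* p↧q≤q↧p) = ceiling-minimal p (ceiling q)
  (ℤ.*-cancelʳ-≤-pos (↥ p) (ceiling q ℤ.* ↧ p) (↧ q) (begin
    ↥ p ℤ.* ↧ q                   ≤⟨ p↧q≤q↧p ⟩
    ↥ q ℤ.* ↧ p                   ≤⟨ ℤ.*-monoʳ-≤-nonNeg (↧ p) (↥≤ceiling*↧ q) ⟩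
    ceiling q ℤ.* ↧ q ℤ.* ↧ p     ≡⟨ swap (ceiling q) (↧ q) (↧ p) ⟩
    ceiling q ℤ.* ↧ p ℤ.* ↧ q     ∎))
  where
  open ℤ.≤-Reasoning
  swap : ∀ a b c → a ℤ.* b ℤ.* c ≡ a ℤ.* c ℤ.* b
  swap = solve-∀

ceiling-pos : ∀ {q} → 0ℚ < q → + 1 ℤ.≤ ceiling q
ceiling-pos {q@record{}} (*<* 0<↥q) = ℤ.i<j⇒suc[i]≤j (ℤ.*-cancelʳ-<-nonNeg {ℤ.0ℤ} {ceiling q} (↧ q) (begin-strict
  ℤ.0ℤ ℤ.* ↧ q       <⟨ 0<↥q ⟩
  ↥ q ℤ.* ℤ.1ℤ       ≡⟨ ℤ.*-identityʳ (↥ q) ⟩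
  ↥ q                ≤⟨ ↥≤ceiling*↧ q ⟩
  ceiling q ℤ.* ↧ q  ∎))
  where open ℤ.≤-Reasoning

toℚ≡mkℚ : ∀ m → toℚ m ≡ mkℚ (+ m) 0 (Coprimality.sym (1-coprimeTo m))
toℚ≡mkℚ m = ℚ.normalize-coprime {m} _

≤toℚ⇒ceiling≤ : ∀ {q} m → q ≤ toℚ m → ceiling q ℤ.≤ + m
≤toℚ⇒ceiling≤ {q@record{}} m q≤m rewrite toℚ≡mkℚ m with q≤m
... | *≤* ↥q*1≤m↧q = ceiling-minimal q (+ m) (subst (ℤ._≤ + m ℤ.* ↧ q) (ℤ.*-identityʳ (↥ q)) ↥q*1≤m↧q)

toℚ-+ : ∀ m n → toℚ (m ℕ.+ n) ≡ toℚ m + toℚ n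
toℚ-+ m n rewrite toℚ≡mkℚ m | toℚ≡mkℚ n = ℚ./-cong {+ (m ℕ.+ n)}
  (trans (ℤ.pos-+ m n) (sym (cong₂ ℤ._+_ (ℤ.*-identityʳ (+ m)) (ℤ.*-identityʳ (+ n))))) refl

toℚ-mono-≤ : ∀ {m n} → m ℕ.≤ n → toℚ m ≤ toℚ n
toℚ-mono-≤ {m} {n} m≤n rewrite toℚ≡mkℚ m | toℚ≡mkℚ n =
  *≤* (subst₂ ℤ._≤_ (sym (ℤ.*-identityʳ (+ m))) (sym (ℤ.*-identityʳ (+ n))) (ℤ.+≤+ m≤n))

toℚ-nonNeg : ∀ m → 0ℚ ≤ toℚ m
toℚ-nonNeg m = toℚ-mono-≤ {0} {m} ℕ.z≤n

0<toℚ : ∀ {m} → 1 ℕ.≤ m → 0ℚ < toℚ m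
0<toℚ {m} 1≤m = ℚ.<-≤-trans (ℚ.positive⁻¹ 1ℚ) (toℚ-mono-≤ {1} {m} 1≤m)

p≤q⇒r-q≤r-p : ∀ r {p q} → p ≤ q → r - q ≤ r - p
p≤q⇒r-q≤r-p r p≤q = ℚ.+-monoʳ-≤ r (ℚ.neg-antimono-≤ p≤q)

p≤p+q : ∀ p {q} → 0ℚ ≤ q → p ≤ p + q
p≤p+q p {q} 0≤q = subst (_≤ p + q) (ℚ.+-identityʳ p) (ℚ.+-monoʳ-≤ p 0≤q)

p≤q⇒0≤q-p : ∀ {p q} → p ≤ q → 0ℚ ≤ q - p
p≤q⇒0≤q-p {p} {q} p≤q = subst (_≤ q - p) (ℚ.+-inverseʳ q) (p≤q⇒r-q≤r-p q p≤q)

p-0≡p : ∀ p → p - 0ℚ ≡ p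
p-0≡p = ℚ.+-identityʳ

p≤q*r⇒p÷r≤q : ∀ {p q r} (0<r : 0ℚ < r) → p ≤ q * r → (p ÷ r) {{>-nonZero 0<r}} ≤ q
p≤q*r⇒p÷r≤q {p} {q} {r} 0<r p≤qr = begin
  p * r⁻¹       ≤⟨ ℚ.*-monoʳ-≤-nonNeg r⁻¹ {{ℚ.pos⇒nonNeg r⁻¹ {{ℚ.1/pos⇒pos r {{ℚ.positive 0<r}}}}}} p≤qr ⟩
  q * r * r⁻¹   ≡⟨ ℚ.*-assoc q r r⁻¹ ⟩
  q * (r * r⁻¹) ≡⟨ cong (q *_) (ℚ.*-inverseʳ r {{>-nonZero 0<r}}) ⟩
  q * 1ℚ        ≡⟨ ℚ.*-identityʳ q ⟩
  q             ∎
  where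
  open ℚ.≤-Reasoning
  r⁻¹ = (1/ r) {{>-nonZero 0<r}}

p*s≤q*r⇒p÷r≤q÷s : ∀ {p q r s} (0<r : 0ℚ < r) (0<s : 0ℚ < s) → p * s ≤ q * r →
           (p ÷ r) {{>-nonZero 0<r}} ≤ (q ÷ s) {{>-nonZero 0<s}}
p*s≤q*r⇒p÷r≤q÷s {p} {q} {r} {s} 0<r 0<s ps≤qr = p≤q*r⇒p÷r≤q {p} {(q ÷ s) {{>-nonZero 0<s}}} 0<r
  (ℚ.*-cancelʳ-≤-pos {p} {(q ÷ s) {{>-nonZero 0<s}} * r} s {{ℚ.positive 0<s}} (begin
    p * s               ≤⟨ ps≤qr ⟩
    q * r               ≡⟨ ℚ.*-identityʳ (q * r) ⟨
    q * r * 1ℚ          ≡⟨ cong (q * r *_) (ℚ.*-inverseʳ s {{>-nonZero 0<s}}) ⟨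
    q * r * (s * s⁻¹)   ≡⟨ regroup q r s s⁻¹ ⟩
    q * s⁻¹ * r * s     ∎))
  where
  open ℚ.≤-Reasoning
  open +-*-Solver
  s⁻¹ = (1/ s) {{>-nonZero 0<s}}
  regroup : ∀ q r s t → q * r * (s * t) ≡ q * t * r * s
  regroup = solve 4 (λ q r s t → q :* r :* (s :* t) := q :* t :* r :* s) refl

÷-pos : ∀ {p r} (0<r : 0ℚ < r) → 0ℚ < p → 0ℚ < (p ÷ r) {{>-nonZero 0<r}}
÷-pos {p} {r} 0<r 0<p = ℚ.positive⁻¹ _ {{ℚ.pos*pos⇒pos p {{ℚ.positive 0<p}} _ {{ℚ.1/pos⇒pos r {{ℚ.positive 0<r}}}}}}

private variable
  A B : Set

-- Stated via foldr and map so that sumℚ (map f xs) from Defs is definitionally ∑ xs f.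
∑ : List A → (A → ℚ) → ℚ
∑ xs f = foldr _+_ 0ℚ (map f xs)

∑-cong : ∀ (xs : List A) {f g} → (∀ x → f x ≡ g x) → ∑ xs f ≡ ∑ xs g
∑-cong []       f≗g = refl
∑-cong (x ∷ xs) f≗g = cong₂ _+_ (f≗g x) (∑-cong xs f≗g)

∑-mono-≤ : ∀ (xs : List A) {f g} → (∀ x → f x ≤ g x) → ∑ xs f ≤ ∑ xs g
∑-mono-≤ []       f≤g = ℚ.≤-refl
∑-mono-≤ (x ∷ xs) f≤g = ℚ.+-mono-≤ (f≤g x) (∑-mono-≤ xs f≤g)

∑-zero : ∀ (xs : List A) → ∑ xs (λ _ → 0ℚ) ≡ 0ℚ
∑-zero []       = refl
∑-zero (x ∷ xs) = trans (ℚ.+-identityˡ _) (∑-zero xs)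

∑-distrib-+ : ∀ (xs : List A) f g → ∑ xs (λ x → f x + g x) ≡ ∑ xs f + ∑ xs g
∑-distrib-+ []       f g = refl
∑-distrib-+ (x ∷ xs) f g =
  trans (cong (_+_ (f x + g x)) (∑-distrib-+ xs f g)) (interchange (f x) (g x) (∑ xs f) (∑ xs g))
  where
  open +-*-Solver
  interchange : ∀ a b c d → a + b + (c + d) ≡ a + c + (b + d)
  interchange = solve 4 (λ a b c d → a :+ b :+ (c :+ d) := a :+ c :+ (b :+ d)) refl

∑-distribʳ-* : ∀ (xs : List A) f c → ∑ xs f * c ≡ ∑ xs (λ x → f x * c)
∑-distribʳ-* []       f c = ℚ.*-zeroˡ c
∑-distribʳ-* (x ∷ xs) f c = trans (ℚ.*-distribʳ-+ c (f x) (∑ xs f)) (cong (_+_ (f x * c)) (∑-distribʳ-* xs f c))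

∑-++ : ∀ (xs ys : List A) f → ∑ (xs ++ ys) f ≡ ∑ xs f + ∑ ys f
∑-++ []       ys f = sym (ℚ.+-identityˡ _)
∑-++ (x ∷ xs) ys f = trans (cong (_+_ (f x)) (∑-++ xs ys f)) (sym (ℚ.+-assoc (f x) _ _))

∑-comm : ∀ (xs : List A) (ys : List B) (g : A → B → ℚ) →
         ∑ xs (λ x → ∑ ys (g x)) ≡ ∑ ys (λ y → ∑ xs (λ x → g x y))
∑-comm []       ys g = sym (∑-zero ys)
∑-comm (x ∷ xs) ys g =
  trans (cong (_+_ (∑ ys (g x))) (∑-comm xs ys g)) (sym (∑-distrib-+ ys (g x) _))

∑-concatMap : ∀ (xs : List B) (h : B → List A) f →
              ∑ (concatMap h xs) f ≡ ∑ xs (λ y → ∑ (h y) f)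
∑-concatMap []       h f = refl
∑-concatMap (y ∷ ys) h f = trans (∑-++ (h y) (concatMap h ys) f) (cong (_+_ (∑ (h y) f)) (∑-concatMap ys h f))

toℚ-sum : ∀ (xs : List A) (f : A → ℕ) → toℚ (sum (map f xs)) ≡ ∑ xs (λ x → toℚ (f x))
toℚ-sum []       f = refl
toℚ-sum (x ∷ xs) f = trans (toℚ-+ (f x) _) (cong (_+_ (toℚ (f x))) (toℚ-sum xs f))

∑-tabulate : ∀ n (f : Fin n → A) g → ∑ (tabulate f) g ≡ ∑ (allFin n) (λ k → g (f k))
∑-tabulate n f g = trans (cong (foldr _+_ 0ℚ) (map-tabulate f g))
                         (sym (cong (foldr _+_ 0ℚ) (map-tabulate (λ k → k) (λ k → g (f k)))))

∑-allFin-≟ : ∀ n (j : Fin n) (h : Fin n → ℚ) → ∑ (allFin n) (λ k → if does (j ≟ k) then h k else 0ℚ) ≡ h j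
∑-allFin-≟ (ℕ.suc n) zero    h = trans (cong (_+_ (h zero)) (trans (∑-tabulate n suc _) (∑-zero (allFin n))))
                                     (ℚ.+-identityʳ (h zero))
∑-allFin-≟ (ℕ.suc n) (suc j) h = trans (ℚ.+-identityˡ _)
                                     (trans (∑-tabulate n suc _) (∑-allFin-≟ n j (λ k → h (suc k))))

sum-mono-≤ : ∀ (xs : List A) {f g : A → ℕ} → (∀ x → f x ℕ.≤ g x) → sum (map f xs) ℕ.≤ sum (map g xs)
sum-mono-≤ []       f≤g = ℕ.z≤n
sum-mono-≤ (x ∷ xs) f≤g = ℕ.+-mono-≤ (f≤g x) (sum-mono-≤ xs f≤g)

∈⇒≤sum : ∀ {xs : List A} {x} (f : A → ℕ) → x ∈ xs → f x ℕ.≤ sum (map f xs)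
∈⇒≤sum f (here refl)           = ℕ.m≤m+n _ _
∈⇒≤sum {xs = y ∷ _} f (there x∈) = ℕ.≤-trans (∈⇒≤sum f x∈) (ℕ.m≤n+m _ (f y))

module _ (I : Instance) where
  open Instance I

  data Window (T : ℚ) : ℚ → List (Placed I) → Set where
    []   : ∀ {L} → L ≤ T → Window T L []
    next : ∀ {L p ps} → L ≤ start p → 0ℚ ≤ len I (item p) → Window T (finish I p) ps → Window T L (p ∷ ps)

  ≤finish : ∀ {L} p → L ≤ start p → 0ℚ ≤ len I (item p) → L ≤ finish I p
  ≤finish p L≤a 0≤ℓ = ℚ.≤-trans L≤a (p≤p+q (start p) 0≤ℓ)

  window-≤ : ∀ {T L ps} → Window T L ps → L ≤ T
  window-≤ ([] L≤T)                   = L≤T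
  window-≤ (next {p = p} L≤a 0≤ℓ w) = ℚ.≤-trans (≤finish p L≤a 0≤ℓ) (window-≤ w)

  len-nonNeg : ∀ x → PieceOK I x → 0ℚ ≤ len I x
  len-nonNeg (setup i)   _   = toℚ-nonNeg (s i)
  len-nonNeg (piece j ℓ) 0<ℓ = ℚ.<⇒≤ 0<ℓ

  machineOK⇒window : ∀ {T ps} → 0ℚ ≤ T → MachineOK I T ps → Window T 0ℚ ps
  machineOK⇒window {ps = []}     0≤T _                             = [] 0≤T
  machineOK⇒window {ps = p ∷ ps} _   (bounds@((0≤a , _) ∷ _) , seq , _) = fromSequential 0≤a bounds seq
    where
    fromSequential : ∀ {T L p ps} → L ≤ start p →
                     All (λ p → 0ℚ ≤ start p × finish I p ≤ T × PieceOK I (item p)) (p ∷ ps) →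
                     Sequential I (p ∷ ps) → Window T L (p ∷ ps)
    fromSequential {p = p} {[]}    L≤a ((_ , b≤T , ok) ∷ []) _ =
      next L≤a (len-nonNeg (item p) ok) ([] b≤T)
    fromSequential {p = p} {_ ∷ _} L≤a ((_ , _ , ok) ∷ bounds) (b≤a′ , seq) =
      next L≤a (len-nonNeg (item p) ok) (fromSequential b≤a′ bounds seq)

  setupTime-≤ : ∀ i {T L ps} → Window T L ps → toℚ (setupsOn I i ps) * toℚ (s i) ≤ T - L
  setupTime-≤ i {T} {L} ([] L≤T) = subst (_≤ T - L) (sym (ℚ.*-zeroˡ (toℚ (s i)))) (p≤q⇒0≤q-p L≤T)
  setupTime-≤ i {T} {L} (next {p = setup i′ at a} {ps} L≤a 0≤ℓ w) with i′ ≟ i | setupTime-≤ i w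
  ... | yes refl | ih = begin
    toℚ (1 ℕ.+ λ′) * S          ≡⟨ cong (_* S) (toℚ-+ 1 λ′) ⟩
    (1ℚ + toℚ λ′) * S           ≡⟨ expand (toℚ λ′) S ⟩
    S + toℚ λ′ * S              ≤⟨ ℚ.+-monoʳ-≤ S ih ⟩
    S + (T - (a + S))           ≡⟨ cancel T a S ⟩
    T - a                       ≤⟨ p≤q⇒r-q≤r-p T L≤a ⟩
    T - L                       ∎
    where
    open ℚ.≤-Reasoning
    open +-*-Solver
    λ′ = setupsOn I i ps
    S = toℚ (s i)
    expand : ∀ x S → (1ℚ + x) * S ≡ S + x * S
    expand = solve 2 (λ x S → (con 1ℚ :+ x) :* S := S :+ x :* S) refl
    cancel : ∀ T a S → S + (T - (a + S)) ≡ T - a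
    cancel = solve 3 (λ T a S → S :+ (T :- (a :+ S)) := T :- a) refl
  ... | no _ | ih = ℚ.≤-trans ih (p≤q⇒r-q≤r-p T (≤finish (setup i′ at a) L≤a 0≤ℓ))
  setupTime-≤ i {T} (next {p = piece j ℓ at a} L≤a 0≤ℓ w) =
    ℚ.≤-trans (setupTime-≤ i w) (p≤q⇒r-q≤r-p T (≤finish (piece j ℓ at a) L≤a 0≤ℓ))

  classLoad : Fin c → List (Placed I) → ℚ
  classLoad i []                        = 0ℚ
  classLoad i ((setup _ at _) ∷ ps)     = classLoad i ps
  classLoad i ((piece j ℓ at _) ∷ ps)   = (if does (cls j ≟ i) then ℓ else 0ℚ) + classLoad i ps

  -- Time left for class i on a machine that is in configuration st from time L on. In
  -- classLoad-≤ every later setup of class i is charged T − s_i, so only this initial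
  -- stretch needs separate accounting.
  room : ℚ → Fin c → Maybe (Fin c) → ℚ → ℚ
  room T i nothing   L = 0ℚ
  room T i (just i′) L = if does (i′ ≟ i) then T - L else 0ℚ

  room-nonNeg : ∀ {T L} i st → L ≤ T → 0ℚ ≤ room T i st L
  room-nonNeg i nothing   L≤T = ℚ.≤-refl
  room-nonNeg i (just i′) L≤T with does (i′ ≟ i)
  ... | true  = p≤q⇒0≤q-p L≤T
  ... | false = ℚ.≤-refl

  classLoad-≤ : ∀ i {T L st ps} → 0ℚ ≤ L → Window T L ps → SetupOK I st ps →
                classLoad i ps ≤ toℚ (setupsOn I i ps) * (T - toℚ (s i)) + room T i st L
  classLoad-≤ i {T} {L} {st} _ ([] L≤T) _ = begin
    0ℚ                                  ≤⟨ room-nonNeg i st L≤T ⟩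
    room T i st L                       ≡⟨ ℚ.+-identityˡ _ ⟨
    0ℚ + room T i st L                  ≡⟨ cong (_+ room T i st L) (ℚ.*-zeroˡ (T - toℚ (s i))) ⟨
    0ℚ * (T - toℚ (s i)) + room T i st L ∎
    where open ℚ.≤-Reasoning
  classLoad-≤ i {T} {L} {st} 0≤L w₀@(next {p = setup i′ at a} {ps} L≤a 0≤ℓ w) ok
    with i′ ≟ i | classLoad-≤ i (ℚ.≤-trans 0≤L (≤finish (setup i′ at a) L≤a 0≤ℓ)) w ok
  ... | yes refl | ih = begin
    classLoad i ps                      ≤⟨ ih ⟩
    toℚ λ′ * D + (T - (a + S))          ≤⟨ ℚ.+-monoʳ-≤ (toℚ λ′ * D) (p≤q⇒r-q≤r-p T S≤a+S) ⟩
    toℚ λ′ * D + D                      ≡⟨ collect (toℚ λ′) D ⟩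
    (1ℚ + toℚ λ′) * D                   ≡⟨ cong (_* D) (toℚ-+ 1 λ′) ⟨
    toℚ (1 ℕ.+ λ′) * D                  ≤⟨ p≤p+q _ (room-nonNeg i st (window-≤ w₀)) ⟩
    toℚ (1 ℕ.+ λ′) * D + room T i st L  ∎
    where
    open ℚ.≤-Reasoning
    open +-*-Solver
    λ′ = setupsOn I i ps
    S = toℚ (s i)
    D = T - S
    S≤a+S : S ≤ a + S
    S≤a+S = subst (_≤ a + S) (ℚ.+-identityˡ S) (ℚ.+-monoˡ-≤ S (ℚ.≤-trans 0≤L L≤a))
    collect : ∀ x D → x * D + D ≡ (1ℚ + x) * D
    collect = solve 2 (λ x D → x :* D :+ D := (con 1ℚ :+ x) :* D) refl
  ... | no _ | ih = ℚ.≤-trans (subst (classLoad i ps ≤_) (ℚ.+-identityʳ λD) ih)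
    (p≤p+q λD (room-nonNeg i st (window-≤ w₀)))
    where λD = toℚ (setupsOn I i ps) * (T - toℚ (s i))
  classLoad-≤ i {T} {L} 0≤L (next {p = piece j ℓ at a} {ps} L≤a 0≤ℓ w) (refl , ok)
    with cls j ≟ i | classLoad-≤ i (ℚ.≤-trans 0≤L (≤finish (piece j ℓ at a) L≤a 0≤ℓ)) w ok
  ... | yes _ | ih = begin
    ℓ + classLoad i ps                  ≤⟨ ℚ.+-monoʳ-≤ ℓ ih ⟩
    ℓ + (λD + (T - (a + ℓ)))            ≡⟨ cancel ℓ λD T a ⟩
    λD + (T - a)                        ≤⟨ ℚ.+-monoʳ-≤ λD (p≤q⇒r-q≤r-p T L≤a) ⟩
    λD + (T - L)                        ∎
    where
    open ℚ.≤-Reasoning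
    open +-*-Solver
    λD = toℚ (setupsOn I i ps) * (T - toℚ (s i))
    cancel : ∀ ℓ x T a → ℓ + (x + (T - (a + ℓ))) ≡ x + (T - a)
    cancel = solve 4 (λ ℓ x T a → ℓ :+ (x :+ (T :- (a :+ ℓ))) := x :+ (T :- a)) refl
  ... | no _ | ih = subst (_≤ toℚ (setupsOn I i ps) * (T - toℚ (s i)) + 0ℚ) (sym (ℚ.+-identityˡ (classLoad i ps))) ih

  jobLoad : Fin n → List (Placed I) → ℚ
  jobLoad j ps = ∑ (piecesOn I j ps) (intervalLen I)

  jobLoad-piece : ∀ j j′ ℓ a ps →
                  jobLoad j ((piece j′ ℓ at a) ∷ ps) ≡ (if does (j′ ≟ j) then ℓ else 0ℚ) + jobLoad j ps
  jobLoad-piece j j′ ℓ a ps with j′ ≟ j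
  ... | yes _ = cong (_+ jobLoad j ps) (a+ℓ-a a ℓ)
    where
    open +-*-Solver
    a+ℓ-a : ∀ a ℓ → a + ℓ - a ≡ ℓ
    a+ℓ-a = solve 2 (λ a ℓ → a :+ ℓ :- a := ℓ) refl
  ... | no _  = sym (ℚ.+-identityˡ (jobLoad j ps))

  classLoad≡∑jobLoad : ∀ i ps → classLoad i ps ≡ ∑ (allFin n) (λ j → if does (cls j ≟ i) then jobLoad j ps else 0ℚ)
  classLoad≡∑jobLoad i [] = sym (trans (∑-cong (allFin n) (λ j → if-eta (does (cls j ≟ i)))) (∑-zero (allFin n)))
  classLoad≡∑jobLoad i ((setup _ at _) ∷ ps) = classLoad≡∑jobLoad i ps
  classLoad≡∑jobLoad i ((piece j′ ℓ at a) ∷ ps) = begin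
    (if inC j′ then ℓ else 0ℚ) + classLoad i ps
      ≡⟨ cong₂ _+_ (∑-allFin-≟ n j′ (λ j → if inC j then ℓ else 0ℚ)) (sym (classLoad≡∑jobLoad i ps)) ⟨
    ∑ (allFin n) (λ j → if does (j′ ≟ j) then (if inC j then ℓ else 0ℚ) else 0ℚ)
      + ∑ (allFin n) (λ j → if inC j then jobLoad j ps else 0ℚ)
      ≡⟨ ∑-distrib-+ (allFin n) _ _ ⟨
    ∑ (allFin n) (λ j → (if does (j′ ≟ j) then (if inC j then ℓ else 0ℚ) else 0ℚ)
                        + (if inC j then jobLoad j ps else 0ℚ))
      ≡⟨ ∑-cong (allFin n) (λ j → cong (_+ _) (if-swap-then (inC j) (does (j′ ≟ j)))) ⟨
    ∑ (allFin n) (λ j → (if inC j then (if does (j′ ≟ j) then ℓ else 0ℚ) else 0ℚ)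
                        + (if inC j then jobLoad j ps else 0ℚ))
      ≡⟨ ∑-cong (allFin n) (λ j → if-distrib-+ (inC j)) ⟨
    ∑ (allFin n) (λ j → if inC j then (if does (j′ ≟ j) then ℓ else 0ℚ) + jobLoad j ps else 0ℚ)
      ≡⟨ ∑-cong (allFin n) (λ j → cong (λ x → if inC j then x else 0ℚ) (jobLoad-piece j j′ ℓ a ps)) ⟨
    ∑ (allFin n) (λ j → if inC j then jobLoad j ((piece j′ ℓ at a) ∷ ps) else 0ℚ) ∎
    where
    open ≡-Reasoning
    inC : Fin n → Bool
    inC j = does (cls j ≟ i)
    if-distrib-+ : ∀ b {x y} → (if b then x + y else 0ℚ) ≡ (if b then x else 0ℚ) + (if b then y else 0ℚ)
    if-distrib-+ true  = refl
    if-distrib-+ false = sym (ℚ.+-identityˡ 0ℚ)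

  1≤classSize : ∀ i → 1 ℕ.≤ P I i
  1≤classSize i with nonempty i
  ... | j , cls-j≡i = ℕ.≤-trans 1≤tⱼ (∈⇒≤sum (λ j → if does (cls j ≟ i) then t j else 0) (∈-allFin j))
    where
    1≤tⱼ : 1 ℕ.≤ (if does (cls j ≟ i) then t j else 0)
    1≤tⱼ with cls j ≟ i
    ... | yes _       = t-pos j
    ... | no cls-j≢i = contradiction cls-j≡i cls-j≢i

  alpha≡ceiling : ∀ {T} i (0<D : 0ℚ < T - toℚ (s i)) →
                  alpha I T i ≡ ceiling ((toℚ (P I i) ÷ (T - toℚ (s i))) {{>-nonZero 0<D}})
  alpha≡ceiling {T} i 0<D with 0ℚ ℚ.<? (T - toℚ (s i))
  ... | yes _   = refl
  ... | no 0≮D = contradiction 0<D 0≮D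

  beta≡ceiling : ∀ {T} i (0<T : 0ℚ < T) → beta I T i ≡ ceiling ((toℚ (2 ℕ.* P I i) ÷ T) {{>-nonZero 0<T}})
  beta≡ceiling {T} i 0<T with 0ℚ ℚ.<? T
  ... | yes _   = refl
  ... | no 0≮T = contradiction 0<T 0≮T

  1≤beta : ∀ {T} i → 0ℚ < T → + 1 ℤ.≤ beta I T i
  1≤beta {T} i 0<T = subst (+ 1 ℤ.≤_) (sym (beta≡ceiling i 0<T))
    (ceiling-pos (÷-pos 0<T (0<toℚ (ℕ.≤-trans (1≤classSize i) (ℕ.m≤m+n (P I i) _)))))

  expensive⇒T<2s : ∀ {T} i → Expensive I T i → T < toℚ (s i) + toℚ (s i)
  expensive⇒T<2s {T} i T½<S = begin-strict
    T                     ≡⟨ halves T ⟩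
    T * ½ + T * ½         <⟨ ℚ.+-mono-< T½<S T½<S ⟩
    toℚ (s i) + toℚ (s i) ∎
    where
    open ℚ.≤-Reasoning
    open +-*-Solver
    halves : ∀ T → T ≡ T * ½ + T * ½
    halves = solve 1 (λ T → T := T :* con ½ :+ T :* con ½) refl

  2capacity≤T : ∀ {T} i → T < toℚ (s i) + toℚ (s i) → (T - toℚ (s i)) + (T - toℚ (s i)) ≤ T
  2capacity≤T {T} i T<2S = begin
    (T - S) + (T - S)     ≡⟨ regroup T S ⟩
    T - ((S + S) - T)     ≤⟨ p≤q⇒r-q≤r-p T (p≤q⇒0≤q-p (ℚ.<⇒≤ T<2S)) ⟩
    T - 0ℚ                ≡⟨ p-0≡p T ⟩
    T                     ∎
    where
    open ℚ.≤-Reasoning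
    open +-*-Solver
    S = toℚ (s i)
    regroup : ∀ T S → (T - S) + (T - S) ≡ T - ((S + S) - T)
    regroup = solve 2 (λ T S → (T :- S) :+ (T :- S) := T :- ((S :+ S) :- T)) refl

  setupsOn≤1 : ∀ i {T ps} → T < toℚ (s i) + toℚ (s i) → 0ℚ ≤ T → MachineOK I T ps → setupsOn I i ps ℕ.≤ 1
  setupsOn≤1 i {T} {ps} T<2S 0≤T ok = ℕ.≮⇒≥ λ 1<λ → ℚ.<-irrefl refl (begin-strict
    S + S            ≡⟨ double S ⟩
    toℚ 2 * S        ≤⟨ ℚ.*-monoʳ-≤-nonNeg S {{ℚ.nonNegative (toℚ-nonNeg (s i))}} (toℚ-mono-≤ {2} {λ′} 1<λ) ⟩
    toℚ λ′ * S       ≤⟨ setupTime-≤ i (machineOK⇒window 0≤T ok) ⟩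
    T - 0ℚ           ≡⟨ p-0≡p T ⟩
    T                <⟨ T<2S ⟩
    S + S            ∎)
    where
    open ℚ.≤-Reasoning
    open +-*-Solver
    S = toℚ (s i)
    λ′ = setupsOn I i ps
    double : ∀ S → S + S ≡ toℚ 2 * S
    double = solve 1 (λ S → S :+ S := con (toℚ 2) :* S) refl

  setupsOn≡0 : ∀ i ps → usesClass I i ps ≡ false → setupsOn I i ps ≡ 0
  setupsOn≡0 i []                       _      = refl
  setupsOn≡0 i ((setup i′ at _) ∷ ps)  unused with i′ ≟ i
  ... | no _ = setupsOn≡0 i ps unused
  setupsOn≡0 i ((piece j _ at _) ∷ ps) unused with cls j ≟ i
  ... | no _ = setupsOn≡0 i ps unused

  setupsOn≤uses : ∀ i {T ps} → T < toℚ (s i) + toℚ (s i) → 0ℚ ≤ T → MachineOK I T ps →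
                  setupsOn I i ps ℕ.≤ (if usesClass I i ps then 1 else 0)
  setupsOn≤uses i {ps = ps} T<2S 0≤T ok with usesClass I i ps in uses
  ... | true  = setupsOn≤1 i T<2S 0≤T ok
  ... | false = ℕ.≤-reflexive (setupsOn≡0 i ps uses)

  module _ {v : Variant I} {T : ℚ} {σ : Schedule I} (feasible : Feasible I v T σ) where

    private
      machines : List (Fin m)
      machines = allFin m

    ∑jobLoad≡t : ∀ j → ∑ machines (λ k → jobLoad j (σ k)) ≡ toℚ (t j)
    ∑jobLoad≡t j = trans (sym (∑-concatMap machines (λ k → piecesOn I j (σ k)) (intervalLen I)))
                         (proj₁ (proj₂ feasible) j)

    classSize≡∑classLoad : ∀ i → toℚ (P I i) ≡ ∑ machines (λ k → classLoad i (σ k))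
    classSize≡∑classLoad i = begin
      toℚ (P I i)
        ≡⟨ toℚ-sum (allFin n) (λ j → if inC j then t j else 0) ⟩
      ∑ (allFin n) (λ j → toℚ (if inC j then t j else 0))
        ≡⟨ ∑-cong (allFin n) job ⟩
      ∑ (allFin n) (λ j → ∑ machines (λ k → if inC j then jobLoad j (σ k) else 0ℚ))
        ≡⟨ ∑-comm (allFin n) machines _ ⟩
      ∑ machines (λ k → ∑ (allFin n) (λ j → if inC j then jobLoad j (σ k) else 0ℚ))
        ≡⟨ ∑-cong machines (λ k → classLoad≡∑jobLoad i (σ k)) ⟨
      ∑ machines (λ k → classLoad i (σ k)) ∎
      where
      open ≡-Reasoning
      inC : Fin n → Bool
      inC j = does (cls j ≟ i)
      job : ∀ j → toℚ (if inC j then t j else 0) ≡ ∑ machines (λ k → if inC j then jobLoad j (σ k) else 0ℚ)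
      job j with inC j
      ... | true  = sym (∑jobLoad≡t j)
      ... | false = sym (∑-zero machines)

    classSize≤setups*capacity : 0ℚ ≤ T → ∀ i → toℚ (P I i) ≤ toℚ (numSetups I σ i) * (T - toℚ (s i))
    classSize≤setups*capacity 0≤T i = begin
      toℚ (P I i)                                   ≡⟨ classSize≡∑classLoad i ⟩
      ∑ machines (λ k → classLoad i (σ k))          ≤⟨ ∑-mono-≤ machines machine ⟩
      ∑ machines (λ k → toℚ (setupsOn I i (σ k)) * D) ≡⟨ ∑-distribʳ-* machines _ D ⟨
      ∑ machines (λ k → toℚ (setupsOn I i (σ k))) * D ≡⟨ cong (_* D) (toℚ-sum machines (λ k → setupsOn I i (σ k))) ⟨
      toℚ (numSetups I σ i) * D                     ∎
      where
      open ℚ.≤-Reasoning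
      D = T - toℚ (s i)
      machine : ∀ k → classLoad i (σ k) ≤ toℚ (setupsOn I i (σ k)) * D
      machine k = subst (classLoad i (σ k) ≤_) (ℚ.+-identityʳ _)
        (classLoad-≤ i ℚ.≤-refl (machineOK⇒window 0≤T (proj₁ feasible k)) (proj₂ (proj₂ (proj₁ feasible k))))

    module _ (0<T : 0ℚ < T) (i : Fin c) where

      0<capacity : 0ℚ < T - toℚ (s i)
      0<capacity = ℚ.≰⇒> λ D≤0 → ℚ.<-irrefl refl (begin-strict
        0ℚ                        <⟨ 0<toℚ (1≤classSize i) ⟩
        toℚ (P I i)               ≤⟨ classSize≤setups*capacity (ℚ.<⇒≤ 0<T) i ⟩
        toℚ λ′ * (T - toℚ (s i))  ≤⟨ ℚ.*-monoˡ-≤-nonNeg (toℚ λ′) {{ℚ.nonNegative (toℚ-nonNeg λ′)}} D≤0 ⟩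
        toℚ λ′ * 0ℚ               ≡⟨ ℚ.*-zeroʳ (toℚ λ′) ⟩
        0ℚ                        ∎)
        where
        open ℚ.≤-Reasoning
        λ′ = numSetups I σ i

      alpha≤numSetups : alpha I T i ℤ.≤ + numSetups I σ i
      alpha≤numSetups = subst (ℤ._≤ + numSetups I σ i) (sym (alpha≡ceiling {T} i 0<capacity))
        (≤toℚ⇒ceiling≤ (numSetups I σ i) (p≤q*r⇒p÷r≤q 0<capacity (classSize≤setups*capacity (ℚ.<⇒≤ 0<T) i)))

      1≤alpha : + 1 ℤ.≤ alpha I T i
      1≤alpha = subst (+ 1 ℤ.≤_) (sym (alpha≡ceiling {T} i 0<capacity))
        (ceiling-pos (÷-pos 0<capacity (0<toℚ (1≤classSize i))))

      module _ (expensive : Expensive I T i) where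

        numSetups≤machinesFor : numSetups I σ i ℕ.≤ machinesFor I σ i
        numSetups≤machinesFor = sum-mono-≤ (allFin m)
          (λ k → setupsOn≤uses i (expensive⇒T<2s i expensive) (ℚ.<⇒≤ 0<T) (proj₁ feasible k))

        beta≤alpha : beta I T i ℤ.≤ alpha I T i
        beta≤alpha = subst₂ ℤ._≤_ (sym (beta≡ceiling i 0<T)) (sym (alpha≡ceiling {T} i 0<capacity))
          (ceiling-mono-≤ (p*s≤q*r⇒p÷r≤q÷s {toℚ (2 ℕ.* P′)} {toℚ P′} 0<T 0<capacity (begin
            toℚ (2 ℕ.* P′) * D       ≡⟨ cong (λ x → toℚ (P′ ℕ.+ x) * D) (ℕ.+-identityʳ P′) ⟩
            toℚ (P′ ℕ.+ P′) * D      ≡⟨ cong (_* D) (toℚ-+ P′ P′) ⟩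
            (toℚ P′ + toℚ P′) * D    ≡⟨ regroup (toℚ P′) D ⟩
            toℚ P′ * (D + D)         ≤⟨ ℚ.*-monoˡ-≤-nonNeg (toℚ P′) {{ℚ.nonNegative (toℚ-nonNeg P′)}}
                                          (2capacity≤T i (expensive⇒T<2s i expensive)) ⟩
            toℚ P′ * T               ∎)))
          where
          open ℚ.≤-Reasoning
          open +-*-Solver
          P′ = P I i
          D = T - toℚ (s i)
          regroup : ∀ p D → (p + p) * D ≡ p * (D + D)
          regroup = solve 2 (λ p D → (p :+ p) :* D := p :* (D :+ D)) refl

lemma2p1 : (I : Instance) (v : Variant I) (T : ℚ) (σ : Schedule I) →
    0ℚ < T → Feasible I v T σ → Makespan I σ T →
    (∀ (i : Fin (Instance.c I)) →
        (alpha I T i ℤ.≤ + numSetups I σ i) × (+ 1 ℤ.≤ alpha I T i))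
    × (∀ (i : Fin (Instance.c I)) → Expensive I T i →
        (alpha I T i ℤ.≤ + numSetups I σ i) × (beta I T i ℤ.≤ alpha I T i)
        × (+ 1 ℤ.≤ beta I T i) × (numSetups I σ i ℕ.≤ machinesFor I σ i))
lemma2p1 I v T σ 0<T feasible _ =
  (λ i → alpha≤numSetups I feasible 0<T i , 1≤alpha I feasible 0<T i) ,
  (λ i expensive → alpha≤numSetups I feasible 0<T i , beta≤alpha I feasible 0<T i expensive ,
                   1≤beta I i 0<T , numSetups≤machinesFor I feasible 0<T i expensive)
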